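{- Let $G$ be a non-abelian group with center $\mathcal Z$ such that for all $a\in G\setminus\mathcal Z$, $C_G(a^G)=\mathcal Z$. Then for every ideal $\mathcal I$ on an index set $\mathbb I$, the reduced power $\mathcal M=\prod_{\mathcal I}G$ interprets the Boolean algebra $(\mathcal P(\mathbb I)/\mathcal I,\subseteq)$ together with the support modulo the center, that is, the function $\mathcal M\to\mathcal P(\mathbb I)/\mathcal I$, $(a_i)_i\mapsto[\{i\in\mathbb I\mid a_i\notin\mathcal Z\}]_{\mathcal I}$.
   Context: $a^G$ is the conjugacy class of $a$, $C_G(S)$ the centralizer of $S$. An ideal $\mathcal I$ on $\mathbb I$ is closed under subsets and finite unions with $\mathbb I\notin\mathcal I$; $\prod_{\mathcal I}G$ is $G^{\mathbb I}$ modulo $(a_i)\simeq(b_i)\iff\{i\mid a_i\neq b_i\}\in\mathcal I$, with coordinatewise multiplication. -}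

module Defs where

open import Level using (0ℓ)
open import Data.Nat using (ℕ; suc; _+_)
open import Data.Fin using (Fin)
open import Data.Product using (Σ; ∃; _×_; _,_)
open import Data.Sum using (_⊎_)
open import Data.Unit using (⊤)
open import Data.Empty using (⊥)
open import Relation.Nullary using (¬_)
open import Relation.Unary using (Pred; _⊆_; _∪_; _∩_; ∅; U)
open import Function.Bundles using (_⇔_)
open import Algebra.Bundles using (Group)
open import Algebra.Bundles.Raw using (RawGroup)
open import Data.Vec.Functional using (_∷_; _++_)

module _ (G : Group 0ℓ 0ℓ) where
  open Group G

  IsAbelian : Set
  IsAbelian = ∀ x y → x ∙ y ≈ y ∙ x

  InCenter : Carrier → Set
  InCenter z = ∀ g → z ∙ g ≈ g ∙ z

  InCentralizerOfClass : Carrier → Carrier → Set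
  InCentralizerOfClass a b = ∀ g → b ∙ ((g ∙ a) ∙ g ⁻¹) ≈ ((g ∙ a) ∙ g ⁻¹) ∙ b

  CentralizersOfClassesAreCenter : Set
  CentralizersOfClassesAreCenter =
    ∀ a → ¬ InCenter a → ∀ b → InCentralizerOfClass a b ⇔ InCenter b

Subset : Set → Set₁
Subset 𝕀 = Pred 𝕀 0ℓ

record IsIdeal (𝕀 : Set) (𝓘 : Subset 𝕀 → Set) : Set₁ where
  field
    empty    : 𝓘 ∅
    downward : ∀ {A B : Subset 𝕀} → A ⊆ B → 𝓘 B → 𝓘 A
    union    : ∀ {A B : Subset 𝕀} → 𝓘 A → 𝓘 B → 𝓘 (A ∪ B)
    proper   : ¬ 𝓘 U

_∖_ : {𝕀 : Set} → Subset 𝕀 → Subset 𝕀 → Subset 𝕀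
(A ∖ B) i = A i × ¬ B i

-- the order of P(𝕀)/𝓘 : [A] ⊆ [B]  iff  A ∖ B ∈ 𝓘
_⊆[_]_ : {𝕀 : Set} → Subset 𝕀 → (Subset 𝕀 → Set) → Subset 𝕀 → Set
A ⊆[ 𝓘 ] B = 𝓘 (A ∖ B)

-- equality in P(𝕀)/𝓘 : [A] = [B]  iff  A Δ B ∈ 𝓘
_≡[_]_ : {𝕀 : Set} → Subset 𝕀 → (Subset 𝕀 → Set) → Subset 𝕀 → Set
A ≡[ 𝓘 ] B = 𝓘 ((A ∖ B) ∪ (B ∖ A))

ReducedPower : (G : Group 0ℓ 0ℓ) (𝕀 : Set) (𝓘 : Subset 𝕀 → Set) → RawGroup 0ℓ 0ℓ
ReducedPower G 𝕀 𝓘 = record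
  { Carrier = 𝕀 → Carrier
  ; _≈_     = λ a b → 𝓘 (λ i → ¬ (a i ≈ b i))
  ; _∙_     = λ a b i → a i ∙ b i
  ; ε       = λ _ → ε
  ; _⁻¹     = λ a i → a i ⁻¹
  }
  where open Group G

supportModCenter : (G : Group 0ℓ 0ℓ) {𝕀 : Set} → (𝕀 → Group.Carrier G) → Subset 𝕀
supportModCenter G a i = ¬ InCenter G (a i)

data Term (n : ℕ) : Set where
  var  : Fin n → Term n
  _·_  : Term n → Term n → Term n
  _⁻¹ᵗ : Term n → Term n
  one  : Term n

data Formula : ℕ → Set where
  _≐_     : ∀ {n} → Term n → Term n → Formula n
  ⊤ᶠ ⊥ᶠ   : ∀ {n} → Formula n
  ¬ᶠ_     : ∀ {n} → Formula n → Formula n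
  _∧ᶠ_ _∨ᶠ_ _⇒ᶠ_ : ∀ {n} → Formula n → Formula n → Formula n
  ∀ᶠ ∃ᶠ   : ∀ {n} → Formula (suc n) → Formula n

module Semantics (M : RawGroup 0ℓ 0ℓ) where
  open RawGroup M

  ⟦_⟧ᵗ : ∀ {n} → Term n → (Fin n → Carrier) → Carrier
  ⟦ var x ⟧ᵗ ρ = ρ x
  ⟦ s · t ⟧ᵗ ρ = ⟦ s ⟧ᵗ ρ ∙ ⟦ t ⟧ᵗ ρ
  ⟦ t ⁻¹ᵗ ⟧ᵗ ρ = ⟦ t ⟧ᵗ ρ ⁻¹
  ⟦ one ⟧ᵗ ρ = ε

  Sat : ∀ {n} → Formula n → (Fin n → Carrier) → Set
  Sat (s ≐ t) ρ = ⟦ s ⟧ᵗ ρ ≈ ⟦ t ⟧ᵗ ρ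
  Sat ⊤ᶠ ρ = ⊤
  Sat ⊥ᶠ ρ = ⊥
  Sat (¬ᶠ φ) ρ = ¬ Sat φ ρ
  Sat (φ ∧ᶠ ψ) ρ = Sat φ ρ × Sat ψ ρ
  Sat (φ ∨ᶠ ψ) ρ = Sat φ ρ ⊎ Sat ψ ρ
  Sat (φ ⇒ᶠ ψ) ρ = Sat φ ρ → Sat ψ ρ
  Sat (∀ᶠ φ) ρ = ∀ (x : Carrier) → Sat φ (x ∷ ρ)
  Sat (∃ᶠ φ) ρ = Σ Carrier λ x → Sat φ (x ∷ ρ)

-- M interprets (P(𝕀)/𝓘, ⊆) together with the support function
-- supp : M → P(𝕀)/𝓘 (parameter-free interpretation):
-- there are k, formulas Dom(x̄), Eq(x̄,ȳ), Le(x̄,ȳ), Supp(z,ȳ) with |x̄|=|ȳ|=k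
-- and a surjection π from Dom(M) onto P(𝕀)/𝓘 such that
--   Eq defines the kernel of π, Le defines the pull-back of ⊆ mod 𝓘,
--   and Supp defines the graph of supp composed with π.

record Interpretation (M : RawGroup 0ℓ 0ℓ) (𝕀 : Set) (𝓘 : Subset 𝕀 → Set)
                      (supp : RawGroup.Carrier M → Subset 𝕀) : Set₁ where
  open RawGroup M
  open Semantics M
  field
    k     : ℕ
    Dom   : Formula k
    Eq    : Formula (k + k)
    Le    : Formula (k + k)
    Supp  : Formula (suc k)
    π     : (x : Fin k → Carrier) → Sat Dom x → Subset 𝕀
    π-surjective : ∀ (A : Subset 𝕀) → Σ (Fin k → Carrier) λ x →
                     Σ (Sat Dom x) λ d → π x d ≡[ 𝓘 ] A
    Eq-correct : ∀ x y (dx : Sat Dom x) (dy : Sat Dom y) →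
                   Sat Eq (x ++ y) ⇔ (π x dx ≡[ 𝓘 ] π y dy)
    Le-correct : ∀ x y (dx : Sat Dom x) (dy : Sat Dom y) →
                   Sat Le (x ++ y) ⇔ (π x dx ⊆[ 𝓘 ] π y dy)
    Supp-correct : ∀ (z : Carrier) y (dy : Sat Dom y) →
                   Sat Supp (z ∷ y) ⇔ (supp z ≡[ 𝓘 ] π y dy)

{-# OPTIONS --safe #-}
module Submission where

-- For b, y in M, "b commutes with every conjugate of y" holds in M iff
-- supp y ∩ supp b ∈ 𝓘: pointwise, the hypothesis on G says that b_i
-- centralizes the class of y_i exactly when y_i or b_i is central, and a
-- classically chosen conjugator witnesses every failure at once. So
-- [supp x] ⊆ [supp y] in P(𝕀)/𝓘 iff the centralizer of the class of y in M
-- is contained in that of x (test with an element whose support is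
-- supp x ∖ supp y), which is first-order. Every class of P(𝕀)/𝓘 is the
-- support of an element, since G has a non-central element.

open import Defs
open import Level using (0ℓ)
open import Relation.Nullary using (¬_; yes; no)
open import Algebra.Bundles using (Group)
open import Axiom.ExcludedMiddle using (ExcludedMiddle)

open import Data.Fin using (Fin; zero; suc)
open import Data.Product using (Σ; _×_; _,_; proj₁; proj₂)
open import Data.Sum using (inj₁; inj₂)
open import Data.Empty using (⊥-elim)
open import Relation.Unary using (_∪_; _∩_; _⊆_; Empty) renaming (_≐_ to _≐ᵖ_)
open import Function.Bundles using (_⇔_; mk⇔; Equivalence)
open import Function.Properties.Equivalence using () renaming (sym to ⇔-sym; trans to ⇔-trans)
open import Data.Product.Function.NonDependent.Propositional using (_×-⇔_)
open import Axiom.DoubleNegationElimination using (em⇒dne)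
open import Data.Vec.Functional using (_∷_; _++_)

open Equivalence using (to; from)

drinker : ExcludedMiddle 0ℓ → {A : Set} (R : A → Set) → A →
          Σ A λ a → R a → ∀ x → R x
drinker em R a with em {Σ _ λ x → ¬ R x}
... | yes (x , ¬Rx) = x , λ Rx → ⊥-elim (¬Rx Rx)
... | no ∄¬R        = a , λ _ x → em⇒dne em (λ ¬Rx → ∄¬R (x , ¬Rx))

module _ (G : Group 0ℓ 0ℓ) where
  open Group G
  open import Relation.Binary.Reasoning.Setoid setoid

  ε-central : InCenter G ε
  ε-central g = trans (identityˡ g) (sym (identityʳ g))

  central⇒conjugate≈ : ∀ {y} → InCenter G y → ∀ g → (g ∙ y) ∙ g ⁻¹ ≈ y
  central⇒conjugate≈ {y} y-central g = begin
    (g ∙ y) ∙ g ⁻¹  ≈⟨ ∙-congʳ (sym (y-central g)) ⟩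
    (y ∙ g) ∙ g ⁻¹  ≈⟨ assoc y g (g ⁻¹) ⟩
    y ∙ (g ∙ g ⁻¹)  ≈⟨ ∙-congˡ (inverseʳ g) ⟩
    y ∙ ε           ≈⟨ identityʳ y ⟩
    y               ∎

  central⇒inCentralizerOfClass : ∀ {y} → InCenter G y → ∀ b → InCentralizerOfClass G y b
  central⇒inCentralizerOfClass {y} y-central b g = begin
    b ∙ ((g ∙ y) ∙ g ⁻¹)  ≈⟨ ∙-congˡ (central⇒conjugate≈ y-central g) ⟩
    b ∙ y                 ≈⟨ sym (y-central b) ⟩
    y ∙ b                 ≈⟨ ∙-congʳ (sym (central⇒conjugate≈ y-central g)) ⟩
    ((g ∙ y) ∙ g ⁻¹) ∙ b  ∎

  ¬inCentralizerOfClass⇔noncentral : CentralizersOfClassesAreCenter G → ∀ y b →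
    (¬ InCentralizerOfClass G y b) ⇔ (¬ InCenter G y × ¬ InCenter G b)
  ¬inCentralizerOfClass⇔noncentral hyp y b = mk⇔
    (λ ¬cent → (λ y-central → ¬cent (central⇒inCentralizerOfClass y-central b))
             , (λ b-central → ¬cent (λ _ → b-central _)))
    (λ (y-noncentral , b-noncentral) cent → b-noncentral (to (hyp y y-noncentral b) cent))

  noncentral-element : ExcludedMiddle 0ℓ → ¬ IsAbelian G → Σ Carrier λ a → ¬ InCenter G a
  noncentral-element em nonabelian =
    let a , all-central = drinker em (InCenter G) ε
    in a , λ a-central → nonabelian (all-central a-central)

module _ {𝕀 : Set} {𝓘 : Subset 𝕀 → Set} (ideal : IsIdeal 𝕀 𝓘) where
  open IsIdeal ideal

  Empty⇒∈ : {A : Subset 𝕀} → Empty A → 𝓘 A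
  Empty⇒∈ A-empty = downward (λ {i} → A-empty i) empty

  ≐⇒≡[] : {A B : Subset 𝕀} → A ≐ᵖ B → A ≡[ 𝓘 ] B
  ≐⇒≡[] (A⊆B , B⊆A) = Empty⇒∈ λ
    { i (inj₁ (Ai , ¬Bi)) → ¬Bi (A⊆B Ai)
    ; i (inj₂ (Bi , ¬Ai)) → ¬Ai (B⊆A Bi) }

  ⊆[]×⊆[]⇔≡[] : {A B : Subset 𝕀} → (A ⊆[ 𝓘 ] B × B ⊆[ 𝓘 ] A) ⇔ A ≡[ 𝓘 ] B
  ⊆[]×⊆[]⇔≡[] = mk⇔ (λ (A⊆B , B⊆A) → union A⊆B B⊆A)
                     (λ A≡B → downward inj₁ A≡B , downward inj₂ A≡B)

  ⊆[]-∩∈ : ExcludedMiddle 0ℓ → {A B C : Subset 𝕀} → A ⊆[ 𝓘 ] B → 𝓘 (B ∩ C) → 𝓘 (A ∩ C)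
  ⊆[]-∩∈ em {A} {B} {C} A⊆B B∩C∈𝓘 = downward split (union A⊆B B∩C∈𝓘)
    where
    split : A ∩ C ⊆ (A ∖ B) ∪ (B ∩ C)
    split {i} (Ai , Ci) with em {B i}
    ... | yes Bi = inj₂ (Bi , Ci)
    ... | no ¬Bi = inj₁ (Ai , ¬Bi)

commutesWithConjugateᶠ : ∀ {n} → Term n → Term n → Term n → Formula n
commutesWithConjugateᶠ b g y = (b · ((g · y) · (g ⁻¹ᵗ))) ≐ (((g · y) · (g ⁻¹ᵗ)) · b)

-- leᶠ p q says C_M(x_q^M) ⊆ C_M(x_p^M); inside it var 1 is b and var 0 is g.
leᶠ : Fin 2 → Fin 2 → Formula 2
leᶠ p q = ∀ᶠ (centralizesClassᶠ q ⇒ᶠ centralizesClassᶠ p)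
  where
  centralizesClassᶠ : Fin 2 → Formula 3
  centralizesClassᶠ r = ∀ᶠ (commutesWithConjugateᶠ (var (suc zero)) (var zero) (var (suc (suc r))))

eqᶠ : Formula 2
eqᶠ = leᶠ zero (suc zero) ∧ᶠ leᶠ (suc zero) zero

module ReducedPowerSupports (em : ExcludedMiddle 0ℓ) (G : Group 0ℓ 0ℓ)
    (hyp : CentralizersOfClassesAreCenter G)
    {𝕀 : Set} {𝓘 : Subset 𝕀 → Set} (ideal : IsIdeal 𝕀 𝓘) where
  open Group G
  open IsIdeal ideal
  open Semantics (ReducedPower G 𝕀 𝓘)

  supp : (𝕀 → Carrier) → Subset 𝕀
  supp = supportModCenter G

  CommutesWithConjugate : Carrier → Carrier → Carrier → Set
  CommutesWithConjugate b g y = b ∙ ((g ∙ y) ∙ g ⁻¹) ≈ ((g ∙ y) ∙ g ⁻¹) ∙ b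

  _centralizesClassOf_ : (𝕀 → Carrier) → (𝕀 → Carrier) → Set
  b centralizesClassOf y = ∀ (g : 𝕀 → Carrier) → 𝓘 (λ i → ¬ CommutesWithConjugate (b i) (g i) (y i))

  centralizesClassOf⇔∩∈ : ∀ b y → b centralizesClassOf y ⇔ 𝓘 (supp y ∩ supp b)
  centralizesClassOf⇔∩∈ b y = mk⇔
    (λ cent → downward (λ {i} → fails-at-witness i) (cent witness))
    (λ ∩∈𝓘 g → downward (λ {i} fails → to (noncentral⇔ i) (λ cent → fails (cent (g i)))) ∩∈𝓘)
    where
    noncentral⇔ : ∀ i → (¬ InCentralizerOfClass G (y i) (b i)) ⇔ (supp y ∩ supp b) i
    noncentral⇔ i = ¬inCentralizerOfClass⇔noncentral G hyp (y i) (b i)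
    commutes-at : 𝕀 → Carrier → Set
    commutes-at i h = CommutesWithConjugate (b i) h (y i)
    witness : 𝕀 → Carrier
    witness i = proj₁ (drinker em (commutes-at i) ε)
    fails-at-witness : ∀ i → (supp y ∩ supp b) i → ¬ commutes-at i (witness i)
    fails-at-witness i noncentral commutes =
      from (noncentral⇔ i) noncentral (proj₂ (drinker em (commutes-at i) ε) commutes)

  module WithNoncentral (a : Carrier) (a-noncentral : ¬ InCenter G a) where

    indicator : Subset 𝕀 → 𝕀 → Carrier
    indicator A i with em {A i}
    ... | yes _ = a
    ... | no _  = ε

    supp-indicator : ∀ A → supp (indicator A) ≐ᵖ A
    supp-indicator A = (λ {i} → supp⊆A i) , (λ {i} → A⊆supp i)
      where
      supp⊆A : ∀ i → supp (indicator A) i → A i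
      supp⊆A i with em {A i}
      ... | yes Ai = λ _ → Ai
      ... | no _   = λ ε-noncentral → ⊥-elim (ε-noncentral (ε-central G))
      A⊆supp : ∀ i → A i → supp (indicator A) i
      A⊆supp i with em {A i}
      ... | yes _  = λ _ → a-noncentral
      ... | no ¬Ai = λ Ai → ⊥-elim (¬Ai Ai)

    supp-⊆[]⇔centralizer-⊇ : ∀ x y →
      supp x ⊆[ 𝓘 ] supp y ⇔ (∀ b → b centralizesClassOf y → b centralizesClassOf x)
    supp-⊆[]⇔centralizer-⊇ x y = mk⇔ centralizer-⊇ supp-⊆[]
      where
      centralizer-⊇ : supp x ⊆[ 𝓘 ] supp y → ∀ b → b centralizesClassOf y → b centralizesClassOf x
      centralizer-⊇ x⊆y b b-cent-y = from (centralizesClassOf⇔∩∈ b x)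
        (⊆[]-∩∈ ideal em x⊆y (to (centralizesClassOf⇔∩∈ b y) b-cent-y))

      b : 𝕀 → Carrier
      b = indicator (supp x ∖ supp y)
      supp-b≐ : supp b ≐ᵖ supp x ∖ supp y
      supp-b≐ = supp-indicator (supp x ∖ supp y)
      b-cent-y : b centralizesClassOf y
      b-cent-y = from (centralizesClassOf⇔∩∈ b y)
        (Empty⇒∈ ideal λ _ (y-noncentral , b-noncentral) → proj₂ (proj₁ supp-b≐ b-noncentral) y-noncentral)
      supp-⊆[] : (∀ b → b centralizesClassOf y → b centralizesClassOf x) → supp x ⊆[ 𝓘 ] supp y
      supp-⊆[] ⊇ = downward (λ x∖y → proj₁ x∖y , proj₂ supp-b≐ x∖y)
        (to (centralizesClassOf⇔∩∈ b x) (⊇ b b-cent-y))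

    sat-leᶠ : ∀ p q ρ → Sat (leᶠ p q) ρ ⇔ supp (ρ p) ⊆[ 𝓘 ] supp (ρ q)
    sat-leᶠ p q ρ = ⇔-sym (supp-⊆[]⇔centralizer-⊇ (ρ p) (ρ q))

    sat-eqᶠ : ∀ ρ → Sat eqᶠ ρ ⇔ supp (ρ zero) ≡[ 𝓘 ] supp (ρ (suc zero))
    sat-eqᶠ ρ = ⇔-trans (sat-leᶠ zero (suc zero) ρ ×-⇔ sat-leᶠ (suc zero) zero ρ) (⊆[]×⊆[]⇔≡[] ideal)

proposition7p6 : ExcludedMiddle 0ℓ →
    (G : Group 0ℓ 0ℓ) → ¬ IsAbelian G → CentralizersOfClassesAreCenter G →
    (𝕀 : Set) (𝓘 : Subset 𝕀 → Set) → IsIdeal 𝕀 𝓘 →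
    Interpretation (ReducedPower G 𝕀 𝓘) 𝕀 𝓘 (supportModCenter G)
proposition7p6 em G nonabelian hyp 𝕀 𝓘 ideal = record
  { k = 1
  ; Dom = ⊤ᶠ
  ; Eq = eqᶠ
  ; Le = leᶠ zero (suc zero)
  ; Supp = eqᶠ
  ; π = λ x _ → supp (x zero)
  ; π-surjective = λ A → (λ _ → indicator A) , _ , ≐⇒≡[] ideal (supp-indicator A)
  ; Eq-correct = λ x y _ _ → sat-eqᶠ (x ++ y)
  ; Le-correct = λ x y _ _ → sat-leᶠ zero (suc zero) (x ++ y)
  ; Supp-correct = λ z y _ → sat-eqᶠ (z ∷ y)
  }
  where
  open ReducedPowerSupports em G hyp ideal
  noncentral : Σ (Group.Carrier G) λ a → ¬ InCenter G a
  noncentral = noncentral-element G em nonabelian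
  open WithNoncentral (proj₁ noncentral) (proj₂ noncentral)
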